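{- Let $n>k\ge 0$ be integers. Let $G$ be a graph having a $\mathcal{G}_n$-model $H$ with model function $\eta$, and let $S\subseteq V(G)$ with $|S|=k$. Then $G-S$ contains a $\mathcal{G}_{n-k}$-model contained in $H$ which contains every row of $H$ and every column of $H$ that contains no vertex of $S$.
   Context: All graphs are finite, simple and undirected. $\mathcal{G}_n$ denotes the $(n\times n)$-grid: vertex set $\{v_{i,j}: i,j\in[n]\}$, with $v_{i,j}$ adjacent to $v_{i',j'}$ iff $|i-i'|+|j-j'|=1$; its $i$-th row is $\{v_{i,1},\dots,v_{i,n}\}$ and its $j$-th column is $\{v_{1,j},\dots,v_{n,j}\}$. A minor-model function of a graph $H_0$ in $G$ is a map $\eta$ on $V(H_0)\cup E(H_0)$ such that the $\eta(v)$ are pairwise vertex-disjoint non-empty connected subgraphs of $G$, the $\eta(e)$ are pairwise distinct edges of $G$, and for each edge $e=uv$, $\eta(e)$ has one end in $V(\eta(u))$ and the other in $V(\eta(v))$. An $H_0$-model is the image of such a function (union of the $\eta(v)$ with the edges $\eta(e)$). For a $\mathcal{G}_n$-model $H$ with model function $\eta$, the $i$-th row (resp. column) of $H$ is the union of $\eta(v)$ over the vertices $v$ of the $i$-th row (resp. column) of $\mathcal{G}_n$. -}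

module Defs where

open import Data.Nat using (ℕ; suc; _∸_; _+_; ∣_-_∣)
open import Data.Fin using (Fin; toℕ)
open import Data.Bool using (Bool; T; false)
open import Data.Product using (Σ; ∃; _×_; _,_; proj₁; proj₂; swap)
open import Data.Sum using (_⊎_)
open import Data.Empty using (⊥)
open import Data.Fin.Subset using (Subset; _∈_; _∉_)
open import Relation.Binary.PropositionalEquality using (_≡_; _≢_)
open import Level using (0ℓ)

record Graph : Set where
  field
    size       : ℕ
    adj        : Fin size → Fin size → Bool
    adj-sym    : ∀ u v → adj u v ≡ adj v u
    adj-irrefl : ∀ u → adj u u ≡ false

  Adj : Fin size → Fin size → Set
  Adj u v = T (adj u v)

open Graph public

record Subgraph (G : Graph) : Set₁ where
  field
    vs     : Fin (size G) → Set
    es     : Fin (size G) → Fin (size G) → Set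
    es-adj : ∀ {a b} → es a b → Adj G a b
    es-vs  : ∀ {a b} → es a b → vs a × vs b
    es-sym : ∀ {a b} → es a b → es b a

open Subgraph public

data Walk {m : ℕ} (E : Fin m → Fin m → Set) : Fin m → Fin m → Set where
  here : ∀ {a} → Walk E a a
  step : ∀ {a b c} → E a b → Walk E b c → Walk E a c

Connected : {G : Graph} → Subgraph G → Set
Connected K = (∃ λ x → vs K x) × (∀ a b → vs K a → vs K b → Walk (es K) a b)

record VE (G : Graph) : Set₁ where
  constructor ve
  field
    vset : Fin (size G) → Set
    eset : Fin (size G) → Fin (size G) → Set

open VE public

_⊆G_ : {G : Graph} → VE G → VE G → Set
A ⊆G B = (∀ x → vset A x → vset B x) × (∀ a b → eset A a b → eset B a b)

-- The edge map is given on
-- ordered pairs and only constrained on edges; eta(e) for e = uv is the G-edge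
-- edge u v = (a , b) with a ∈ eta(u), b ∈ eta(v); edge v u is its reversal.
record MinorModel (G : Graph) (V : Set) (A : V → V → Set) : Set₁ where
  field
    branch           : V → Subgraph G
    branch-connected : ∀ v → Connected (branch v)
    branch-disjoint  : ∀ u v → u ≢ v → ∀ x → vs (branch u) x → vs (branch v) x → ⊥
    edge             : V → V → Fin (size G) × Fin (size G)
    edge-ok          : ∀ u v → A u v →
                         vs (branch u) (proj₁ (edge u v)) ×
                         vs (branch v) (proj₂ (edge u v)) ×
                         Adj G (proj₁ (edge u v)) (proj₂ (edge u v))
    edge-sym         : ∀ u v → A u v → edge v u ≡ swap (edge u v)
    edge-distinct    : ∀ u v u′ v′ → A u v → A u′ v′ →
                         edge u v ≡ edge u′ v′ → (u ≡ u′ × v ≡ v′)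

open MinorModel public

image : {G : Graph} {V : Set} {A : V → V → Set} → MinorModel G V A → VE G
image {A = A} M = ve (λ x → ∃ λ v → vs (branch M v) x)
                     (λ a b → (∃ λ v → es (branch M v) a b)
                              ⊎ (∃ λ u → ∃ λ v → A u v × edge M u v ≡ (a , b)))

-- The (n × n)-grid: vertices v_{i,j} = (i , j) (0-based indices).
GridAdj : (n : ℕ) → Fin n × Fin n → Fin n × Fin n → Set
GridAdj n (i , j) (i′ , j′) = ∣ toℕ i - toℕ i′ ∣ + ∣ toℕ j - toℕ j′ ∣ ≡ 1

GridModel : Graph → ℕ → Set₁
GridModel G n = MinorModel G (Fin n × Fin n) (GridAdj n)

row : {G : Graph} {n : ℕ} → GridModel G n → Fin n → VE G
row M i = ve (λ x → ∃ λ j → vs (branch M (i , j)) x)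
             (λ a b → ∃ λ j → es (branch M (i , j)) a b)

column : {G : Graph} {n : ℕ} → GridModel G n → Fin n → VE G
column M j = ve (λ x → ∃ λ i → vs (branch M (i , j)) x)
                (λ a b → ∃ λ i → es (branch M (i , j)) a b)

Avoids : {G : Graph} → VE G → Subset (size G) → Set
Avoids K S = ∀ x → vset K x → x ∉ S

-- Call a row of H hit if S meets the skeleton (a root joined to all endpoints of model edges) of
-- one of its cells; branch sets are disjoint, so at most k rows and k columns are hit.  Cut the
-- rows into n − k intervals of consecutive rows, each containing a row that is not hit, its
-- representative, and cut the columns likewise.  The branch set of cell (a , b) of the new grid
-- is collected from the cells of H in the rectangle (a-th row interval) × (b-th column interval):
-- the whole branch set of a cell whose row or column of H avoids S, and the skeleton of a cell
-- on a representative row or column.  Every such piece is joined, along its own row or column,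
-- to the cross formed by the representative row and column of the rectangle, and the
-- representative rows and columns also carry the model edges between neighbouring rectangles.
module Submission where

open import Defs
open import Data.Nat using (ℕ; _<_; _∸_)
open import Data.Product using (Σ; _×_)
open import Data.Fin.Subset using (Subset; ∣_∣)
open import Relation.Binary.PropositionalEquality using (_≡_)

open import Data.Nat using (zero; suc; _+_; _≤_; z≤n; s≤s; ∣_-_∣)
open import Data.Nat.Properties as ℕ
  using (≤-trans; ≤-pred; n≤0⇒n≡0; +-suc; +-monoʳ-≤; ≤-<-trans; m≤m+n; ≡-irrelevant)
open import Data.Fin using (Fin; toℕ; fromℕ<)
import Data.Fin as Fin
open import Data.Fin.Properties using (toℕ-injective; toℕ-fromℕ<; toℕ<n; any?; ¬Fin0)
  renaming (_≟_ to _≟ᶠ_)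
open import Data.Fin.Subset using (inside; outside; _∈_; _∉_)
open import Data.Vec using ([]; _∷_; here; there)
open import Data.List using (List; []; _∷_; length; mapMaybe)
import Data.List as List
open import Data.List.Properties using (length-map; length-mapMaybe)
open import Data.List.Membership.Propositional using () renaming (_∈_ to _∈ₗ_; _∉_ to _∉ₗ_)
open import Data.List.Membership.Propositional.Properties using (∈-map⁺)
open import Data.List.Relation.Unary.Any using (here; there)
import Data.List.Relation.Unary.Any as Any
import Data.List.Relation.Unary.Any.Properties as Any
open import Data.List.Relation.Binary.Subset.Propositional using (_⊆_)
import Data.Maybe as Maybe
open import Data.Maybe using (Maybe; just)
import Data.Maybe.Relation.Unary.Any as MaybeAny
open import Data.Product using (∃; _,_; proj₁; proj₂; swap)
open import Data.Product.Properties using (≡-dec)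
open import Data.Sum using (_⊎_; inj₁; inj₂)
open import Data.Empty using (⊥; ⊥-elim)
open import Function using (_∘_; id)
open import Relation.Binary.Definitions using (DecidableEquality)
open import Relation.Binary.PropositionalEquality using (_≢_; refl; sym; trans; cong; cong₂; subst)
open import Relation.Nullary using (Dec; yes; no)
open import Relation.Nullary.Decidable using (map′; _⊎-dec_; dec⇒maybe)
import Data.List.Membership.DecPropositional as DecMembership

module _ {N : ℕ} {E : Fin N → Fin N → Set} where

  infixr 5 _◅◅_
  _◅◅_ : ∀ {a b c} → Walk E a b → Walk E b c → Walk E a c
  here       ◅◅ w = w
  step e w′ ◅◅ w = step e (w′ ◅◅ w)

  reverseWalk : (∀ {a b} → E a b → E b a) → ∀ {a b} → Walk E a b → Walk E b a
  reverseWalk E-sym here       = here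
  reverseWalk E-sym (step e w) = reverseWalk E-sym w ◅◅ step (E-sym e) here

  vertices : ∀ {a b} → Walk E a b → List (Fin N)
  vertices {a} here       = a ∷ []
  vertices {a} (step _ w) = a ∷ vertices w

  start∈vertices : ∀ {a b} (w : Walk E a b) → a ∈ₗ vertices w
  start∈vertices here       = here refl
  start∈vertices (step _ _) = here refl

  end∈vertices : ∀ {a b} (w : Walk E a b) → b ∈ₗ vertices w
  end∈vertices here       = here refl
  end∈vertices (step _ w) = there (end∈vertices w)

  prefix : ∀ {a b x} (w : Walk E a b) → x ∈ₗ vertices w →
           Σ (Walk E a x) λ w′ → vertices w′ ⊆ vertices w
  prefix here       (here refl) = here , id
  prefix (step _ w) (here refl) = here , λ { (here refl) → here refl }
  prefix (step e w) (there x∈)  with prefix w x∈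
  ... | w′ , w′⊆w = step e w′ , λ { (here refl) → here refl ; (there y∈) → there (w′⊆w y∈) }

  vertices-closed : (Q : Fin N → Set) → (∀ {a b} → E a b → Q b) →
                    ∀ {a b x} → Q a → (w : Walk E a b) → x ∈ₗ vertices w → Q x
  vertices-closed Q Q-step qa here       (here refl) = qa
  vertices-closed Q Q-step qa (step _ _) (here refl) = qa
  vertices-closed Q Q-step qa (step e w) (there x∈)  = vertices-closed Q Q-step (Q-step e) w x∈

  restrictWalk : {E′ : Fin N → Fin N → Set} (P : Fin N → Set) →
                 (∀ {a b} → E a b → P a → P b → E′ a b) →
                 ∀ {a b} (w : Walk E a b) → (∀ {x} → x ∈ₗ vertices w → P x) → Walk E′ a b
  restrictWalk P lift here       _   = here
  restrictWalk P lift (step e w) all =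
    step (lift e (all (here refl)) (all (there (start∈vertices w)))) (restrictWalk P lift w (all ∘ there))

module _ {n N : ℕ} {E : Fin N → Fin N → Set} (g : Fin n → Fin N) (P : Fin n → Set)
         (P-convex : ∀ {i j k} → toℕ i ≤ toℕ j → toℕ j ≤ toℕ k → P i → P k → P j)
         (link : ∀ {t t′} → suc (toℕ t) ≡ toℕ t′ → P t → P t′ → Walk E (g t) (g t′)) where

  private
    walkUp : ∀ d {i i′} → toℕ i + d ≡ toℕ i′ → P i → P i′ → Walk E (g i) (g i′)
    walkUp zero    {i}      i+0≡i′ _  _   =
      subst (λ i′ → Walk E (g i) (g i′)) (toℕ-injective (trans (sym (ℕ.+-identityʳ (toℕ i))) i+0≡i′)) here
    walkUp (suc d) {i} {i′} i+d≡i′ pi pi′ =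
      link (sym (toℕ-fromℕ< next<n)) pi pnext ◅◅ walkUp d next+d≡i′ pnext pi′
      where
      next≤i′ : suc (toℕ i) ≤ toℕ i′
      next≤i′ = subst (suc (toℕ i) ≤_) (trans (sym (+-suc (toℕ i) d)) i+d≡i′) (s≤s (m≤m+n (toℕ i) d))
      next<n : suc (toℕ i) < n
      next<n = ≤-<-trans next≤i′ (toℕ<n i′)
      next+d≡i′ : toℕ (fromℕ< next<n) + d ≡ toℕ i′
      next+d≡i′ = trans (cong (_+ d) (toℕ-fromℕ< next<n)) (trans (sym (+-suc (toℕ i) d)) i+d≡i′)
      pnext : P (fromℕ< next<n)
      pnext = P-convex (subst (toℕ i ≤_) (sym (toℕ-fromℕ< next<n)) (ℕ.n≤1+n (toℕ i)))
                       (subst (_≤ toℕ i′) (sym (toℕ-fromℕ< next<n)) next≤i′) pi pi′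

  walkAlong : (∀ {a b} → E a b → E b a) → ∀ {j j′} → P j → P j′ → Walk E (g j) (g j′)
  walkAlong E-sym {j} {j′} pj pj′ with ℕ.≤-total (toℕ j) (toℕ j′)
  ... | inj₁ j≤j′ = walkUp (toℕ j′ ∸ toℕ j) (ℕ.m+[n∸m]≡n j≤j′) pj pj′
  ... | inj₂ j′≤j = reverseWalk E-sym (walkUp (toℕ j ∸ toℕ j′) (ℕ.m+[n∸m]≡n j′≤j) pj′ pj)

shiftDown : ∀ {n} → List (Fin (suc n)) → List (Fin n)
shiftDown []               = []
shiftDown (Fin.zero  ∷ is) = shiftDown is
shiftDown (Fin.suc i ∷ is) = i ∷ shiftDown is

length-shiftDown : ∀ {n} (is : List (Fin (suc n))) → length (shiftDown is) ≤ length is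
length-shiftDown []               = z≤n
length-shiftDown (Fin.zero  ∷ is) = ℕ.m≤n⇒m≤1+n (length-shiftDown is)
length-shiftDown (Fin.suc i ∷ is) = s≤s (length-shiftDown is)

length-shiftDown-zero : ∀ {n} {is : List (Fin (suc n))} → Fin.zero ∈ₗ is → length (shiftDown is) < length is
length-shiftDown-zero {is = Fin.zero  ∷ is} (here refl) = s≤s (length-shiftDown is)
length-shiftDown-zero {is = Fin.zero  ∷ is} (there 0∈) = ℕ.m≤n⇒m≤1+n (length-shiftDown-zero 0∈)
length-shiftDown-zero {is = Fin.suc _ ∷ is} (there 0∈) = s≤s (length-shiftDown-zero 0∈)

∈-shiftDown : ∀ {n} {i : Fin n} {is} → Fin.suc i ∈ₗ is → i ∈ₗ shiftDown is
∈-shiftDown {is = Fin.zero  ∷ is} (there i∈)  = ∈-shiftDown i∈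
∈-shiftDown {is = Fin.suc _ ∷ is} (here refl) = here refl
∈-shiftDown {is = Fin.suc _ ∷ is} (there i∈)  = there (∈-shiftDown i∈)

∉-shiftDown : ∀ {n} {i : Fin n} {is} → i ∉ₗ shiftDown is → Fin.suc i ∉ₗ is
∉-shiftDown i∉ = i∉ ∘ ∈-shiftDown

elements : ∀ {N} → Subset N → List (Fin N)
elements []            = []
elements (inside  ∷ p) = Fin.zero ∷ List.map Fin.suc (elements p)
elements (outside ∷ p) = List.map Fin.suc (elements p)

length-elements : ∀ {N} (p : Subset N) → length (elements p) ≡ ∣ p ∣
length-elements []            = refl
length-elements (inside  ∷ p) = cong suc (trans (length-map Fin.suc (elements p)) (length-elements p))
length-elements (outside ∷ p) = trans (length-map Fin.suc (elements p)) (length-elements p)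

∈-elements : ∀ {N} {p : Subset N} {x} → x ∈ p → x ∈ₗ elements p
∈-elements {p = inside  ∷ p} here       = here refl
∈-elements {p = inside  ∷ p} (there x∈) = there (∈-map⁺ Fin.suc (∈-elements x∈))
∈-elements {p = outside ∷ p} (there x∈) = ∈-map⁺ Fin.suc (∈-elements x∈)

∈-mapMaybe⁺ : ∀ {A B : Set} {f : A → Maybe B} {xs x y} → x ∈ₗ xs → f x ≡ just y → y ∈ₗ mapMaybe f xs
∈-mapMaybe⁺ {f = f} {xs} {y = y} x∈xs fx≡y =
  Any.mapMaybe⁺ f xs (Any.map⁺ (Any.map (λ { refl → subst (MaybeAny.Any (y ≡_)) (sym fx≡y) (MaybeAny.just refl) })
                                         x∈xs))

∣-∣≡1⇒consecutive : ∀ x y → ∣ x - y ∣ ≡ 1 → suc x ≡ y ⊎ suc y ≡ x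
∣-∣≡1⇒consecutive zero    (suc y) ∣x-y∣≡1 = inj₁ (sym ∣x-y∣≡1)
∣-∣≡1⇒consecutive (suc x) zero    ∣x-y∣≡1 = inj₂ (sym ∣x-y∣≡1)
∣-∣≡1⇒consecutive (suc x) (suc y) ∣x-y∣≡1 with ∣-∣≡1⇒consecutive x y ∣x-y∣≡1
... | inj₁ 1+x≡y = inj₁ (cong suc 1+x≡y)
... | inj₂ 1+y≡x = inj₂ (cong suc 1+y≡x)

consecutive⇒∣-∣≡1 : ∀ {x y} → suc x ≡ y → ∣ x - y ∣ ≡ 1
consecutive⇒∣-∣≡1 {zero}  refl = refl
consecutive⇒∣-∣≡1 {suc x} refl = consecutive⇒∣-∣≡1 {x} refl

data GridStep {n : ℕ} : Fin n × Fin n → Fin n × Fin n → Set where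
  horizontal : ∀ {i j j′} → suc (toℕ j) ≡ toℕ j′ → GridStep (i , j) (i , j′)
  vertical   : ∀ {i i′ j} → suc (toℕ i) ≡ toℕ i′ → GridStep (i , j) (i′ , j)

gridStep⇒adj : ∀ {n} {u v : Fin n × Fin n} → GridStep u v → GridAdj n u v
gridStep⇒adj {u = i , _} (horizontal e) = cong₂ _+_ (ℕ.∣n-n∣≡0 (toℕ i)) (consecutive⇒∣-∣≡1 e)
gridStep⇒adj {u = _ , j} (vertical e)   = cong₂ _+_ (consecutive⇒∣-∣≡1 e) (ℕ.∣n-n∣≡0 (toℕ j))

gridAdj-sym : ∀ {n} {u v : Fin n × Fin n} → GridAdj n u v → GridAdj n v u
gridAdj-sym {u = i , j} {i′ , j′} =
  trans (cong₂ _+_ (ℕ.∣-∣-comm (toℕ i′) (toℕ i)) (ℕ.∣-∣-comm (toℕ j′) (toℕ j)))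

gridAdj? : ∀ {n} (u v : Fin n × Fin n) → Dec (GridAdj n u v)
gridAdj? (i , j) (i′ , j′) = ∣ toℕ i - toℕ i′ ∣ + ∣ toℕ j - toℕ j′ ∣ ℕ.≟ 1

gridAdj⇒step : ∀ {n} {u v : Fin n × Fin n} → GridAdj n u v → GridStep u v ⊎ GridStep v u
gridAdj⇒step {u = i , j} {i′ , j′} adj with ∣ toℕ i - toℕ i′ ∣ in ∣i-i′∣≡
... | zero
  with toℕ-injective {i = i} {i′} (ℕ.∣m-n∣≡0⇒m≡n ∣i-i′∣≡) | ∣-∣≡1⇒consecutive (toℕ j) (toℕ j′) adj
...   | refl | inj₁ 1+j≡j′ = inj₁ (horizontal 1+j≡j′)
...   | refl | inj₂ 1+j′≡j = inj₂ (horizontal 1+j′≡j)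
gridAdj⇒step {u = i , j} {i′ , j′} adj | suc zero
  with toℕ-injective {i = j} {j′} (ℕ.∣m-n∣≡0⇒m≡n (ℕ.suc-injective adj))
     | ∣-∣≡1⇒consecutive (toℕ i) (toℕ i′) ∣i-i′∣≡
...   | refl | inj₁ 1+i≡i′ = inj₁ (vertical 1+i≡i′)
...   | refl | inj₂ 1+i′≡i = inj₂ (vertical 1+i′≡i)
gridAdj⇒step {u = i , j} {i′ , j′} () | suc (suc _)

-- The blocks are the fibres of block; they are intervals by monotonicity, and by after-rep the
-- representative of every block but the last is its last element.
record Blocking (n m : ℕ) (Good : Fin n → Set) : Set where
  field
    block      : Fin n → Fin m
    rep        : Fin m → Fin n
    block-rep  : ∀ a → block (rep a) ≡ a
    rep-good   : ∀ a → Good (rep a)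
    block-mono : ∀ {i j} → toℕ i ≤ toℕ j → toℕ (block i) ≤ toℕ (block j)
    after-rep  : ∀ {a a′} → suc (toℕ a) ≡ toℕ a′ →
                 Σ (Fin n) λ i → toℕ i ≡ suc (toℕ (rep a)) × block i ≡ a′

  IsRep : Fin n → Set
  IsRep i = rep (block i) ≡ i

  rep-isRep : ∀ a → IsRep (rep a)
  rep-isRep a = cong rep (block-rep a)

  isRep-good : ∀ {i} → IsRep i → Good i
  isRep-good {i} e = subst Good e (rep-good (block i))

  block-convex : ∀ {i j k a} → toℕ i ≤ toℕ j → toℕ j ≤ toℕ k →
                 block i ≡ a → block k ≡ a → block j ≡ a
  block-convex {i} {j} {k} i≤j j≤k refl bk≡bi =
    toℕ-injective (ℕ.≤-antisym (subst (λ b → toℕ (block j) ≤ toℕ b) bk≡bi (block-mono j≤k)) (block-mono i≤j))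

  -- The element of block a at which the edge towards block a′ is attached: the first element
  -- if a′ precedes a, so that toward a a′ and toward a′ a are consecutive, and rep a otherwise.
  toward : Fin m → Fin m → Fin n
  toward a a′ with toℕ a ℕ.≟ suc (toℕ a′)
  ... | yes a≡1+a′ = proj₁ (after-rep (sym a≡1+a′))
  ... | no  _      = rep a

  block-toward : ∀ a a′ → block (toward a a′) ≡ a
  block-toward a a′ with toℕ a ℕ.≟ suc (toℕ a′)
  ... | yes a≡1+a′ = proj₂ (proj₂ (after-rep (sym a≡1+a′)))
  ... | no  _      = block-rep a

  toward-isRep : ∀ a → IsRep (toward a a)
  toward-isRep a with toℕ a ℕ.≟ suc (toℕ a)
  ... | yes a≡1+a = ⊥-elim (ℕ.1+n≢n (sym a≡1+a))
  ... | no  _     = rep-isRep a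

  toward-next : ∀ {a a′} → suc (toℕ a) ≡ toℕ a′ → suc (toℕ (toward a a′)) ≡ toℕ (toward a′ a)
  toward-next {a} {a′} 1+a≡a′ with toℕ a ℕ.≟ suc (toℕ a′) | toℕ a′ ℕ.≟ suc (toℕ a)
  ... | yes a≡1+a′ | _           = ⊥-elim (ℕ.<-asym (subst (toℕ a <_) 1+a≡a′ (ℕ.n<1+n _))
                                                                 (subst (toℕ a′ <_) (sym a≡1+a′) (ℕ.n<1+n _)))
  ... | no _       | yes a′≡1+a  = sym (proj₁ (proj₂ (after-rep (sym a′≡1+a))))
  ... | no _       | no  a′≢1+a  = ⊥-elim (a′≢1+a (sym 1+a≡a′))

open Blocking

block-zero : ∀ {n m P} (B : Blocking (suc n) (suc m) P) → block B Fin.zero ≡ Fin.zero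
block-zero B = toℕ-injective (n≤0⇒n≡0 (subst (λ a → toℕ (block B Fin.zero) ≤ toℕ a)
                                              (block-rep B Fin.zero) (block-mono B z≤n)))

oneBlock : ∀ {n P} → P Fin.zero → Blocking (suc n) 1 P
oneBlock p0 = record
  { block      = λ _ → Fin.zero
  ; rep        = λ _ → Fin.zero
  ; block-rep  = λ { Fin.zero → refl }
  ; rep-good   = λ { Fin.zero → p0 }
  ; block-mono = λ _ → z≤n
  ; after-rep  = λ { {Fin.zero} {Fin.zero} () }
  }

skipFirst : ∀ {n m P} → Blocking n (suc m) (P ∘ Fin.suc) → Blocking (suc n) (suc m) P
skipFirst B = record
  { block      = λ { Fin.zero → Fin.zero ; (Fin.suc i) → block B i }
  ; rep        = Fin.suc ∘ rep B
  ; block-rep  = block-rep B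
  ; rep-good   = rep-good B
  ; block-mono = λ { {Fin.zero} _ → z≤n ; {Fin.suc i} {Fin.suc j} (s≤s i≤j) → block-mono B i≤j }
  ; after-rep  = λ 1+a≡a′ → let (i , i≡ , bi≡) = after-rep B 1+a≡a′ in Fin.suc i , cong suc i≡ , bi≡
  }

newFirstBlock : ∀ {n m P} → P Fin.zero → Blocking n (suc m) (P ∘ Fin.suc) →
                Blocking (suc n) (suc (suc m)) P
newFirstBlock {zero}  p0 B = ⊥-elim (¬Fin0 (rep B Fin.zero))
newFirstBlock {suc n} {m} p0 B = record
  { block      = block′
  ; rep        = rep′
  ; block-rep  = λ { Fin.zero → refl ; (Fin.suc a) → cong Fin.suc (block-rep B a) }
  ; rep-good   = λ { Fin.zero → p0 ; (Fin.suc a) → rep-good B a }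
  ; block-mono = λ { {Fin.zero} _ → z≤n ; {Fin.suc i} {Fin.suc j} (s≤s i≤j) → s≤s (block-mono B i≤j) }
  ; after-rep  = after-rep′
  }
  where
  block′ : Fin (suc (suc n)) → Fin (suc (suc m))
  block′ Fin.zero    = Fin.zero
  block′ (Fin.suc i) = Fin.suc (block B i)
  rep′ : Fin (suc (suc m)) → Fin (suc (suc n))
  rep′ Fin.zero    = Fin.zero
  rep′ (Fin.suc a) = Fin.suc (rep B a)
  after-rep′ : ∀ {a a′} → suc (toℕ a) ≡ toℕ a′ →
               Σ (Fin (suc (suc n))) λ i → toℕ i ≡ suc (toℕ (rep′ a)) × block′ i ≡ a′
  after-rep′ {Fin.zero}  {Fin.suc Fin.zero} refl = Fin.suc Fin.zero , refl , cong Fin.suc (block-zero B)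
  after-rep′ {Fin.suc a} {Fin.suc a′} 1+a≡a′ =
    let (i , i≡ , bi≡) = after-rep B (ℕ.suc-injective 1+a≡a′) in Fin.suc i , cong suc i≡ , cong Fin.suc bi≡

blocking : ∀ n m (bad : List (Fin n)) {P : Fin n → Set} → (∀ {i} → i ∉ₗ bad → P i) →
           1 ≤ m → m + length bad ≤ n → Blocking n m P
blocking zero    (suc m) bad good _ ()
blocking (suc n) (suc m) bad {P} good _ m+b≤1+n with DecMembership._∈?_ _≟ᶠ_ Fin.zero bad
... | yes 0∈bad = skipFirst (blocking n (suc m) (shiftDown bad) (good ∘ ∉-shiftDown) (s≤s z≤n) bound)
  where
  bound : suc m + length (shiftDown bad) ≤ n
  bound = ≤-pred (≤-trans (s≤s (subst (_≤ m + length bad) (+-suc m _) (+-monoʳ-≤ m (length-shiftDown-zero 0∈bad))))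
                          m+b≤1+n)
... | no 0∉bad = startAtZero m m+b≤1+n
  where
  startAtZero : ∀ m′ → suc m′ + length bad ≤ suc n → Blocking (suc n) (suc m′) P
  startAtZero zero     _        = oneBlock (good 0∉bad)
  startAtZero (suc m′) m′+b<1+n = newFirstBlock (good 0∉bad)
    (blocking n (suc m′) (shiftDown bad) (good ∘ ∉-shiftDown) (s≤s z≤n)
              (≤-trans (+-monoʳ-≤ (suc m′) (length-shiftDown bad)) (≤-pred m′+b<1+n)))

module _ {G : Graph} {V : Set} {A : V → V → Set} (H : MinorModel G V A) where

  branch-unique : DecidableEquality V → ∀ {u v x} → vs (branch H u) x → vs (branch H v) x → u ≡ v
  branch-unique _≟_ {u} {v} {x} x∈u x∈v with u ≟ v
  ... | yes u≡v = u≡v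
  ... | no  u≢v = ⊥-elim (branch-disjoint H u v u≢v x x∈u x∈v)

module Skeleton {G : Graph} {V : Set} {A : V → V → Set} (H : MinorModel G V A) where

  root : V → Fin (size G)
  root u = proj₁ (proj₁ (branch-connected H u))

  root∈branch : ∀ u → vs (branch H u) (root u)
  root∈branch u = proj₂ (proj₁ (branch-connected H u))

  branchWalk : ∀ u {x y} → vs (branch H u) x → vs (branch H u) y → Walk (es (branch H u)) x y
  branchWalk u = proj₂ (branch-connected H u) _ _

  toEndpoint : ∀ u v → A u v → Walk (es (branch H u)) (root u) (proj₁ (edge H u v))
  toEndpoint u v p = branchWalk u (root∈branch u) (proj₁ (edge-ok H u v p))

  -- Unlike the branch set, this part of it is given by finitely many walks, so membership is
  -- decidable once A and V are (see skeleton? for the grid).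
  Skeleton : V → Fin (size G) → Set
  Skeleton u x = x ≡ root u ⊎ Σ V λ v → Σ (A u v) λ p → x ∈ₗ vertices (toEndpoint u v p)

  skeleton⊆branch : ∀ {u x} → Skeleton u x → vs (branch H u) x
  skeleton⊆branch {u} (inj₁ refl)          = root∈branch u
  skeleton⊆branch {u} (inj₂ (v , p , x∈)) =
    vertices-closed (vs (branch H u)) (proj₂ ∘ es-vs (branch H u)) (root∈branch u) (toEndpoint u v p) x∈

  endpoint∈skeleton : ∀ {u v} (p : A u v) → Skeleton u (proj₁ (edge H u v))
  endpoint∈skeleton {u} {v} p = inj₂ (v , p , end∈vertices (toEndpoint u v p))

module Contraction {G : Graph} {V : Set} {A : V → V → Set} (H : MinorModel G V A)
                   (A-sym : ∀ {u v} → A u v → A v u)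
                   {W : Set} (blockOf : V → W) (Kept : V → Fin (size G) → Set) where

  open Skeleton H

  data InFibre (β : W) (x : Fin (size G)) : Set where
    kept : ∀ c → blockOf c ≡ β → vs (branch H c) x → Kept c x → InFibre β x

  data FibreEdge (β : W) (x y : Fin (size G)) : Set where
    inner : ∀ c → blockOf c ≡ β → es (branch H c) x y → Kept c x → Kept c y → FibreEdge β x y
    cross : ∀ u v → blockOf u ≡ β → blockOf v ≡ β → A u v → edge H u v ≡ (x , y) →
            Kept u x → Kept v y → FibreEdge β x y

  fibreEdge-sym : ∀ {β x y} → FibreEdge β x y → FibreEdge β y x
  fibreEdge-sym (inner c c∈β e kx ky)                = inner c c∈β (es-sym (branch H c) e) ky kx
  fibreEdge-sym (cross u v u∈β v∈β p uv≡xy kx ky) =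
    cross v u v∈β u∈β (A-sym p) (trans (edge-sym H u v p) (cong swap uv≡xy)) ky kx

  Fibre : W → Subgraph G
  Fibre β = record
    { vs     = InFibre β
    ; es     = FibreEdge β
    ; es-adj = λ where
        (inner c _ e _ _)           → es-adj (branch H c) e
        (cross u v _ _ p uv≡xy _ _) →
          subst (λ e → Adj G (proj₁ e) (proj₂ e)) uv≡xy (proj₂ (proj₂ (edge-ok H u v p)))
    ; es-vs  = λ where
        (inner c c∈β e kx ky) →
          kept c c∈β (proj₁ (es-vs (branch H c) e)) kx , kept c c∈β (proj₂ (es-vs (branch H c) e)) ky
        (cross u v u∈β v∈β p uv≡xy kx ky) →
            kept u u∈β (subst (vs (branch H u)) (cong proj₁ uv≡xy) (proj₁ (edge-ok H u v p))) kx
          , kept v v∈β (subst (vs (branch H v)) (cong proj₂ uv≡xy) (proj₁ (proj₂ (edge-ok H u v p)))) ky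
    ; es-sym = fibreEdge-sym
    }

  fibre-disjoint : ∀ β β′ → β ≢ β′ → ∀ x → InFibre β x → InFibre β′ x → ⊥
  fibre-disjoint β β′ β≢β′ x (kept c refl x∈c _) (kept c′ refl x∈c′ _) =
    branch-disjoint H c c′ (β≢β′ ∘ cong blockOf) x x∈c x∈c′

  liftBranchWalk : ∀ {c β x y} → blockOf c ≡ β → (w : Walk (es (branch H c)) x y) →
                   (∀ {z} → z ∈ₗ vertices w → Kept c z) → Walk (FibreEdge β) x y
  liftBranchWalk {c} c∈β = restrictWalk (Kept c) (inner c c∈β)

  SkeletonKept : V → Set
  SkeletonKept c = ∀ {x} → Skeleton c x → Kept c x

  skeletonWalk : ∀ {c x} → SkeletonKept c → Skeleton c x → Walk (FibreEdge (blockOf c)) (root c) x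
  skeletonWalk sk (inj₁ refl)           = here
  skeletonWalk {c} sk (inj₂ (v , p , x∈)) with prefix (toEndpoint c v p) x∈
  ... | w , w⊆ = liftBranchWalk refl w (λ z∈ → sk (inj₂ (v , p , w⊆ z∈)))

  adjacentRootWalk : ∀ {u v β} → A u v → blockOf u ≡ β → blockOf v ≡ β → SkeletonKept u → SkeletonKept v →
                     Walk (FibreEdge β) (root u) (root v)
  adjacentRootWalk {u} {v} {β} p u∈β v∈β sku skv =
    liftBranchWalk u∈β (toEndpoint u v p) (λ z∈ → sku (inj₂ (v , p , z∈)))
    ◅◅ step crossing (subst (λ z → Walk (FibreEdge β) z (root v)) vu≡uv
                        (reverseWalk fibreEdge-sym
                          (liftBranchWalk v∈β (toEndpoint v u (A-sym p)) (λ z∈ → skv (inj₂ (u , A-sym p , z∈))))))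
    where
    vu≡uv : proj₁ (edge H v u) ≡ proj₂ (edge H u v)
    vu≡uv = cong proj₁ (edge-sym H u v p)
    crossing : FibreEdge β (proj₁ (edge H u v)) (proj₂ (edge H u v))
    crossing = cross u v u∈β v∈β p refl (sku (endpoint∈skeleton p))
                     (subst (Kept v) vu≡uv (skv (endpoint∈skeleton (A-sym p))))

  module Contracted {A′ : W → W → Set} (A′-sym : ∀ {u v} → A′ u v → A′ v u)
                    (pick : W → W → V) (pick-block : ∀ u v → blockOf (pick u v) ≡ u)
                    (pick-adj : ∀ {u v} → A′ u v → A (pick u v) (pick v u))
                    (pick-kept : ∀ {u v} → A′ u v → Kept (pick u v) (proj₁ (edge H (pick u v) (pick v u))))
                    (fibre-connected : ∀ β → Connected (Fibre β)) where

    model : MinorModel G W A′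
    model = record
      { branch           = Fibre
      ; branch-connected = fibre-connected
      ; branch-disjoint  = fibre-disjoint
      ; edge             = λ u v → edge H (pick u v) (pick v u)
      ; edge-ok          = edge-ok′
      ; edge-sym         = λ u v p → edge-sym H (pick u v) (pick v u) (pick-adj p)
      ; edge-distinct    = edge-distinct′
      }
      where
      edge-ok′ : ∀ u v → A′ u v →
                 let (x , y) = edge H (pick u v) (pick v u) in InFibre u x × InFibre v y × Adj G x y
      edge-ok′ u v p =
          kept (pick u v) (pick-block u v) (proj₁ ok) (pick-kept p)
        , kept (pick v u) (pick-block v u) (proj₁ (proj₂ ok))
               (subst (Kept (pick v u)) (cong proj₁ (edge-sym H (pick u v) (pick v u) (pick-adj p))) (pick-kept (A′-sym p)))
        , proj₂ (proj₂ ok)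
        where ok = edge-ok H (pick u v) (pick v u) (pick-adj p)
      edge-distinct′ : ∀ u v u′ v′ → A′ u v → A′ u′ v′ →
                       edge H (pick u v) (pick v u) ≡ edge H (pick u′ v′) (pick v′ u′) → u ≡ u′ × v ≡ v′
      edge-distinct′ u v u′ v′ p p′ e with edge-distinct H _ _ _ _ (pick-adj p) (pick-adj p′) e
      ... | uv≡u′v′ , vu≡v′u′ =
            trans (sym (pick-block u v)) (trans (cong blockOf uv≡u′v′) (pick-block u′ v′))
          , trans (sym (pick-block v u)) (trans (cong blockOf vu≡v′u′) (pick-block v′ u′))

    image⊆image : image model ⊆G image H
    image⊆image = (λ { x (β , kept c _ x∈c _) → c , x∈c })
                , λ where
                    a b (inj₁ (β , inner c _ e _ _))            → inj₁ (c , e)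
                    a b (inj₁ (β , cross u v _ _ p uv≡ab _ _)) → inj₂ (u , v , p , uv≡ab)
                    a b (inj₂ (u , v , p , uv≡ab))              → inj₂ (pick u v , pick v u , pick-adj p , uv≡ab)

    image-kept : ∀ {x} → vset (image model) x → ∃ λ c → vs (branch H c) x × Kept c x
    image-kept (β , kept c _ x∈c kx) = c , x∈c , kx

    branch⊆image : ∀ c → (∀ {x} → vs (branch H c) x → Kept c x) →
                   ve (vs (branch H c)) (es (branch H c)) ⊆G image model
    branch⊆image c all-kept =
        (λ x x∈c → blockOf c , kept c refl x∈c (all-kept x∈c))
      , (λ a b e → inj₁ (blockOf c , inner c refl e (all-kept (proj₁ (es-vs (branch H c) e)))
                                                    (all-kept (proj₂ (es-vs (branch H c) e)))))

module Grid {G : Graph} {n : ℕ} (H : GridModel G n) (S : Subset (size G)) where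

  open Skeleton H

  Cell : Set
  Cell = Fin n × Fin n

  anyCell? : {P : Cell → Set} → (∀ c → Dec (P c)) → Dec (∃ P)
  anyCell? P? = map′ (λ (i , j , p) → (i , j) , p) (λ ((i , j) , p) → i , j , p)
                     (any? λ i → any? λ j → P? (i , j))

  skeleton? : ∀ c x → Dec (Skeleton c x)
  skeleton? c x = (x ≟ᶠ root c) ⊎-dec anyCell? onWalkTo?
    where
    onWalkTo? : ∀ c′ → Dec (Σ (GridAdj n c c′) λ p → x ∈ₗ vertices (toEndpoint c c′ p))
    onWalkTo? c′ with gridAdj? c c′
    ... | no ¬adj = no (¬adj ∘ proj₁)
    ... | yes adj = map′ (adj ,_)
                         (λ (adj′ , x∈) → subst (λ p → x ∈ₗ vertices (toEndpoint c c′ p))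
                                                (≡-irrelevant adj′ adj) x∈)
                         (DecMembership._∈?_ _≟ᶠ_ x (vertices (toEndpoint c c′ adj)))

  cellOf : Fin (size G) → Maybe Cell
  cellOf x = Maybe.map proj₁ (dec⇒maybe (anyCell? λ c → skeleton? c x))

  cellOf-skeleton : ∀ {c x} → Skeleton c x → cellOf x ≡ just c
  cellOf-skeleton {c} {x} s with anyCell? (λ c → skeleton? c x)
  ... | yes (c′ , s′) = cong just (branch-unique H (≡-dec _≟ᶠ_ _≟ᶠ_) (skeleton⊆branch s′) (skeleton⊆branch s))
  ... | no  ∄c        = ⊥-elim (∄c (c , s))

  hitLines : (Cell → Fin n) → List (Fin n)
  hitLines coordinate = mapMaybe (Maybe.map coordinate ∘ cellOf) (elements S)

  length-hitLines : ∀ coordinate → length (hitLines coordinate) ≤ ∣ S ∣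
  length-hitLines coordinate =
    subst (length (hitLines coordinate) ≤_) (length-elements S) (length-mapMaybe _ (elements S))

  ∈-hitLines : ∀ coordinate {c x} → x ∈ S → Skeleton c x → coordinate c ∈ₗ hitLines coordinate
  ∈-hitLines coordinate x∈S s = ∈-mapMaybe⁺ (∈-elements x∈S) (cong (Maybe.map coordinate) (cellOf-skeleton s))

  CleanRow CleanColumn : Fin n → Set
  CleanRow    i = ∀ j {x} → Skeleton (i , j) x → x ∉ S
  CleanColumn j = ∀ i {x} → Skeleton (i , j) x → x ∉ S

  rowBlocking : ∀ m → 1 ≤ m → m + ∣ S ∣ ≤ n → Blocking n m CleanRow
  rowBlocking m 1≤m m+∣S∣≤n =
    blocking n m (hitLines proj₁) (λ i∉ j s x∈S → i∉ (∈-hitLines proj₁ x∈S s)) 1≤m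
             (≤-trans (+-monoʳ-≤ m (length-hitLines proj₁)) m+∣S∣≤n)

  columnBlocking : ∀ m → 1 ≤ m → m + ∣ S ∣ ≤ n → Blocking n m CleanColumn
  columnBlocking m 1≤m m+∣S∣≤n =
    blocking n m (hitLines proj₂) (λ j∉ i s x∈S → j∉ (∈-hitLines proj₂ x∈S s)) 1≤m
             (≤-trans (+-monoʳ-≤ m (length-hitLines proj₂)) m+∣S∣≤n)

  module GridContraction {m : ℕ} (R : Blocking n m CleanRow) (C : Blocking n m CleanColumn) where

    private
      module R = Blocking R
      module C = Blocking C

    RowFree ColumnFree : Fin n → Set
    RowFree    i = Avoids (row H i) S
    ColumnFree j = Avoids (column H j) S

    blockOf : Cell → Fin m × Fin m
    blockOf (i , j) = R.block i , C.block j

    -- Skeletons of cells on representative rows and columns avoid S, as those lines are not hit.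
    Kept : Cell → Fin (size G) → Set
    Kept (i , j) x = (RowFree i ⊎ ColumnFree j) ⊎ (Skeleton (i , j) x × (R.IsRep i ⊎ C.IsRep j))

    kept-avoids : ∀ {c x} → vs (branch H c) x → Kept c x → x ∉ S
    kept-avoids {i , j} x∈c (inj₁ (inj₁ row-free))          = row-free _ (j , x∈c)
    kept-avoids {i , j} x∈c (inj₁ (inj₂ column-free))       = column-free _ (i , x∈c)
    kept-avoids {i , j} x∈c (inj₂ (s , inj₁ row-isRep))    = R.isRep-good row-isRep j s
    kept-avoids {i , j} x∈c (inj₂ (s , inj₂ column-isRep)) = C.isRep-good column-isRep i s

    open Contraction H (λ {u} {v} → gridAdj-sym {u = u} {v}) blockOf Kept

    RowUsable ColumnUsable : Fin n → Set
    RowUsable    i = RowFree i ⊎ R.IsRep i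
    ColumnUsable j = ColumnFree j ⊎ C.IsRep j

    rowUsable-skeletonKept : ∀ {i j} → RowUsable i → SkeletonKept (i , j)
    rowUsable-skeletonKept (inj₁ row-free)  _ = inj₁ (inj₁ row-free)
    rowUsable-skeletonKept (inj₂ row-isRep) s = inj₂ (s , inj₁ row-isRep)

    columnUsable-skeletonKept : ∀ {i j} → ColumnUsable j → SkeletonKept (i , j)
    columnUsable-skeletonKept (inj₁ column-free)  _ = inj₁ (inj₂ column-free)
    columnUsable-skeletonKept (inj₂ column-isRep) s = inj₂ (s , inj₂ column-isRep)

    kept-usable : ∀ {i j x} → Kept (i , j) x → RowUsable i ⊎ ColumnUsable j
    kept-usable (inj₁ (inj₁ row-free))          = inj₁ (inj₁ row-free)
    kept-usable (inj₁ (inj₂ column-free))       = inj₂ (inj₁ column-free)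
    kept-usable (inj₂ (_ , inj₁ row-isRep))    = inj₁ (inj₂ row-isRep)
    kept-usable (inj₂ (_ , inj₂ column-isRep)) = inj₂ (inj₂ column-isRep)

    rootWalk : ∀ {c x} → vs (branch H c) x → Kept c x → Walk (FibreEdge (blockOf c)) (root c) x
    rootWalk {c} x∈c (inj₁ free)       = liftBranchWalk refl (branchWalk c (root∈branch c) x∈c) (λ _ → inj₁ free)
    rootWalk     x∈c (inj₂ (s , isRep)) = skeletonWalk (λ s′ → inj₂ (s′ , isRep)) s

    rowWalk : ∀ {i a b j j′} → R.block i ≡ a → RowUsable i → C.block j ≡ b → C.block j′ ≡ b →
              Walk (FibreEdge (a , b)) (root (i , j)) (root (i , j′))
    rowWalk {i} {b = b} i∈a usable =
      walkAlong (λ t → root (i , t)) (λ t → C.block t ≡ b) C.block-convex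
        (λ {t} {t′} 1+t≡t′ t∈b t′∈b → adjacentRootWalk (gridStep⇒adj (horizontal {i = i} {t} {t′} 1+t≡t′))
                                (cong₂ _,_ i∈a t∈b) (cong₂ _,_ i∈a t′∈b)
                                (rowUsable-skeletonKept usable) (rowUsable-skeletonKept usable))
        fibreEdge-sym

    columnWalk : ∀ {j a b i i′} → C.block j ≡ b → ColumnUsable j → R.block i ≡ a → R.block i′ ≡ a →
                 Walk (FibreEdge (a , b)) (root (i , j)) (root (i′ , j))
    columnWalk {j} {a} j∈b usable =
      walkAlong (λ t → root (t , j)) (λ t → R.block t ≡ a) R.block-convex
        (λ {t} {t′} 1+t≡t′ t∈a t′∈a → adjacentRootWalk (gridStep⇒adj (vertical {i = t} {t′} {j} 1+t≡t′))
                                (cong₂ _,_ t∈a j∈b) (cong₂ _,_ t′∈a j∈b)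
                                (columnUsable-skeletonKept usable) (columnUsable-skeletonKept usable))
        fibreEdge-sym

    centre : Fin m × Fin m → Fin (size G)
    centre (a , b) = root (R.rep a , C.rep b)

    centre∈fibre : ∀ β → InFibre β (centre β)
    centre∈fibre (a , b) = kept (R.rep a , C.rep b) (cong₂ _,_ (R.block-rep a) (C.block-rep b))
                                (root∈branch _) (inj₂ (inj₁ refl , inj₁ (R.rep-isRep a)))

    toCentre : ∀ {β x} → InFibre β x → Walk (FibreEdge β) x (centre β)
    toCentre (kept (i , j) refl x∈c k) with kept-usable k
    ... | inj₁ row-usable =
      reverseWalk fibreEdge-sym (rootWalk x∈c k)
      ◅◅ rowWalk refl row-usable refl (C.block-rep _)
      ◅◅ columnWalk (C.block-rep _) (inj₂ (C.rep-isRep _)) refl (R.block-rep _)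
    ... | inj₂ column-usable =
      reverseWalk fibreEdge-sym (rootWalk x∈c k)
      ◅◅ columnWalk refl column-usable refl (R.block-rep _)
      ◅◅ rowWalk (R.block-rep _) (inj₂ (R.rep-isRep _)) refl (C.block-rep _)

    fibre-connected : ∀ β → Connected (Fibre β)
    fibre-connected β = (centre β , centre∈fibre β) ,
      λ x y x∈β y∈β → toCentre x∈β ◅◅ reverseWalk fibreEdge-sym (toCentre y∈β)

    pick : Fin m × Fin m → Fin m × Fin m → Cell
    pick (a , b) (a′ , b′) = R.toward a a′ , C.toward b b′

    pick-block : ∀ u v → blockOf (pick u v) ≡ u
    pick-block (a , b) (a′ , b′) = cong₂ _,_ (R.block-toward a a′) (C.block-toward b b′)

    pick-step : ∀ {u v} → GridStep u v → GridStep (pick u v) (pick v u)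
    pick-step (horizontal 1+b≡b′) = horizontal (C.toward-next 1+b≡b′)
    pick-step (vertical 1+a≡a′)   = vertical (R.toward-next 1+a≡a′)

    pick-adj : ∀ {u v} → GridAdj m u v → GridAdj n (pick u v) (pick v u)
    pick-adj {u} {v} adj with gridAdj⇒step {u = u} {v} adj
    ... | inj₁ u→v = gridStep⇒adj (pick-step u→v)
    ... | inj₂ v→u = gridAdj-sym {u = pick v u} {pick u v} (gridStep⇒adj (pick-step v→u))

    pick-isRep : ∀ {u v} → GridStep u v ⊎ GridStep v u →
                 R.IsRep (proj₁ (pick u v)) ⊎ C.IsRep (proj₂ (pick u v))
    pick-isRep (inj₁ (horizontal {i} _)) = inj₁ (R.toward-isRep i)
    pick-isRep (inj₁ (vertical {j = j} _)) = inj₂ (C.toward-isRep j)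
    pick-isRep (inj₂ (horizontal {i} _)) = inj₁ (R.toward-isRep i)
    pick-isRep (inj₂ (vertical {j = j} _)) = inj₂ (C.toward-isRep j)

    pick-kept : ∀ {u v} → GridAdj m u v → Kept (pick u v) (proj₁ (edge H (pick u v) (pick v u)))
    pick-kept {u} {v} adj = inj₂ ( endpoint∈skeleton {pick u v} {pick v u} (pick-adj {u} {v} adj)
                                 , pick-isRep (gridAdj⇒step {u = u} {v} adj))

    open Contracted (λ {u} {v} → gridAdj-sym {u = u} {v}) pick pick-block
                    (λ {u} {v} → pick-adj {u} {v}) (λ {u} {v} → pick-kept {u} {v}) fibre-connected public

    image-avoids : Avoids (image model) S
    image-avoids x x∈image with image-kept x∈image
    ... | c , x∈c , kx = kept-avoids x∈c kx

    freeRow⊆image : ∀ i → RowFree i → row H i ⊆G image model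
    freeRow⊆image i free = (λ x (j , x∈) → proj₁ (branch⊆image (i , j) (λ _ → inj₁ (inj₁ free))) x x∈)
                         , (λ a b (j , e) → proj₂ (branch⊆image (i , j) (λ _ → inj₁ (inj₁ free))) a b e)

    freeColumn⊆image : ∀ j → ColumnFree j → column H j ⊆G image model
    freeColumn⊆image j free = (λ x (i , x∈) → proj₁ (branch⊆image (i , j) (λ _ → inj₁ (inj₂ free))) x x∈)
                            , (λ a b (i , e) → proj₂ (branch⊆image (i , j) (λ _ → inj₁ (inj₂ free))) a b e)

lemma2p2 : (n k : ℕ) → k < n → (G : Graph) → (H : GridModel G n) →
               (S : Subset (size G)) → ∣ S ∣ ≡ k →
               Σ (GridModel G (n ∸ k)) (λ H′ →
                 Avoids (image H′) S ×
                 image H′ ⊆G image H ×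
                 (∀ i → Avoids (row H i) S → row H i ⊆G image H′) ×
                 (∀ j → Avoids (column H j) S → column H j ⊆G image H′))
lemma2p2 n k k<n G H S ∣S∣≡k = model , image-avoids , image⊆image , freeRow⊆image , freeColumn⊆image
  where
  open Grid H S

  0<m : 1 ≤ n ∸ k
  0<m = ℕ.m<n⇒0<n∸m k<n

  m+∣S∣≡n : n ∸ k + ∣ S ∣ ≡ n
  m+∣S∣≡n = trans (cong (n ∸ k +_) ∣S∣≡k) (ℕ.m∸n+n≡m (ℕ.<⇒≤ k<n))

  open GridContraction (rowBlocking (n ∸ k) 0<m (ℕ.≤-reflexive m+∣S∣≡n))
                       (columnBlocking (n ∸ k) 0<m (ℕ.≤-reflexive m+∣S∣≡n))
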